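{- Let $G=(G,s,t)$ be a nontrivial string. Let $a,b\in I_5=\{ -5,\dots,5\}$ be integers with $a\equiv b\pmod 2$ such that $(a,b)$ is valid for $G$. Then $G$ admits an $(a,b)$-pseudoflow if one of the following holds: (a) $\beta(G)$ is odd and $a\neq\pm b$; (b) $\beta(G)$ is even and $a=\pm b$; (c) $\beta(G)\ge 2$ and either $a$ is odd, or $a=0$, or $b=0$.
   Context: A signed graph is a loopless graph (parallel edges allowed) with edges labelled positive or negative. An orientation treats each edge as two half-edges oriented independently: exactly one half-edge points towards its endvertex for a positive edge, none or both for a negative edge. Two-terminal graphs have distinct source $s$ and target $t$; the series connection of $G_1,\dots,G_n$ identifies the target of $G_i$ with the source of $G_{i+1}$, with terminals the source of $G_1$ and target of $G_n$. $K_2^+$ is the positive $K_2$ and $D$ the unbalanced $2$-cycle (one positive and one negative parallel edge). A string is a series connection of copies of $K_2^+$ and $D$ in which every non-terminal vertex lies in a $2$-cycle; it is nontrivial if it has more than two vertices. $\beta(G)$ is the number of distinct $2$-cycles in $G$. A pseudoflow on a two-terminal signed graph is an orientation with a valuation of edges by non-zero integers of absolute value less than $6$ such that at every non-terminal vertex the total value on incoming half-edges equals the total value on outgoing half-edges (no condition at terminals); it is an $(a,b)$-pseudoflow if the (net) outflow at the source terminal equals $a$ and the (net) inflow at the target terminal equals $b$. The pair $(a,b)$ is valid for $(G,s,t)$ if ($a\neq 0$ or $\deg(s)\ge 2$) and ($b\ne 0$ or $\deg(t)\ge 2$). -}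

module Defs where

open import Data.Bool using (Bool; true; false; if_then_else_)
open import Data.Nat as ℕ using (ℕ; zero; suc)
open import Data.Fin as Fin using (Fin; inject₁; fromℕ)
open import Data.List as List using (List; length; lookup; concatMap; allFin; [_]; _∷_; [])
open import Data.Integer as ℤ using (ℤ; _+_; -_; ∣_∣; 0ℤ; 1ℤ)
open import Data.Product using (Σ; _×_; _,_; ∃; ∃-syntax)
open import Data.Sum using (_⊎_)
open import Relation.Nullary using (¬_; Dec; yes; no)
open import Relation.Nullary.Decidable using (_×-dec_; _⊎-dec_; ⌊_⌋)
open import Relation.Binary.PropositionalEquality using (_≡_; _≢_)

data Sign : Set where
  pos neg : Sign

record Edge (n : ℕ) : Set where
  constructor edge
  field
    u v : Fin n
    sign : Sign

record SignedGraph : Set where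
  field
    nV : ℕ
    edges : List (Edge nV)
  E : Set
  E = Fin (length edges)
  ends : E → Edge nV
  ends = lookup edges

open SignedGraph public

sumℤ : (n : ℕ) → (Fin n → ℤ) → ℤ
sumℤ zero f = 0ℤ
sumℤ (suc n) f = f Fin.zero + sumℤ n (λ i → f (Fin.suc i))

count : (n : ℕ) → (Fin n → Bool) → ℕ
count zero f = 0
count (suc n) f = (if f Fin.zero then 1 else 0) ℕ.+ count n (λ i → f (Fin.suc i))

sumℕ : (n : ℕ) → (Fin n → ℕ) → ℕ
sumℕ zero f = 0
sumℕ (suc n) f = f Fin.zero ℕ.+ sumℕ n (λ i → f (Fin.suc i))

module _ (G : SignedGraph) where
  private
    n = nV G

  IncidentTo : Fin n → E G → Set
  IncidentTo w e = Edge.u (ends G e) ≡ w ⊎ Edge.v (ends G e) ≡ w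

  SameEnds : E G → E G → Set
  SameEnds e f =
    (Edge.u (ends G e) ≡ Edge.u (ends G f) × Edge.v (ends G e) ≡ Edge.v (ends G f))
    ⊎ (Edge.u (ends G e) ≡ Edge.v (ends G f) × Edge.v (ends G e) ≡ Edge.u (ends G f))

  sameEnds? : (e f : E G) → Dec (SameEnds e f)
  sameEnds? e f =
    ((Edge.u (ends G e) Fin.≟ Edge.u (ends G f)) ×-dec (Edge.v (ends G e) Fin.≟ Edge.v (ends G f)))
    ⊎-dec ((Edge.u (ends G e) Fin.≟ Edge.v (ends G f)) ×-dec (Edge.v (ends G e) Fin.≟ Edge.u (ends G f)))

  -- degree: number of edges incident to w (graph is loopless)
  deg : Fin n → ℕ
  deg w = count (length (edges G))
    (λ e → ⌊ (Edge.u (ends G e) Fin.≟ w) ⊎-dec (Edge.v (ends G e) Fin.≟ w) ⌋)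

  -- β(G): number of distinct 2-cycles, i.e. of unordered pairs {e,f}
  -- of distinct parallel edges (counted as pairs e < f)
  β : ℕ
  β = sumℕ (length (edges G)) (λ e → count (length (edges G))
        (λ f → ⌊ (Fin.toℕ e ℕ.<? Fin.toℕ f) ×-dec sameEnds? e f ⌋))

  -- v lies in a 2-cycle: two distinct parallel edges, one (hence both) at v
  InTwoCycle : Fin n → Set
  InTwoCycle w = Σ (E G) λ e → Σ (E G) λ f → e ≢ f × SameEnds e f × IncidentTo w e

record TwoTerminal : Set where
  field
    graph : SignedGraph
    s t : Fin (nV graph)
    s≢t : s ≢ t

-- Strings: series connections of K₂⁺ and D.

data Block : Set where
  K₂⁺ D : Block

blockEdges : {n : ℕ} → Block → Fin n → Fin n → List (Edge n)
blockEdges K₂⁺ x y = [ edge x y pos ]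
blockEdges D   x y = edge x y pos ∷ edge x y neg ∷ []

seriesGraph : List Block → SignedGraph
seriesGraph bs = record
  { nV = suc (length bs)
  ; edges = concatMap (λ i → blockEdges (lookup bs i) (inject₁ i) (Fin.suc i)) (allFin (length bs)) }

seriesSource : (bs : List Block) → Fin (nV (seriesGraph bs))
seriesSource bs = Fin.zero

seriesTarget : (bs : List Block) → Fin (nV (seriesGraph bs))
seriesTarget bs = fromℕ (length bs)

seriesTwoTerminal : (bs : List Block) → 1 ℕ.≤ length bs → TwoTerminal
seriesTwoTerminal (b ∷ bs) _ = record
  { graph = seriesGraph (b ∷ bs)
  ; s = seriesSource (b ∷ bs)
  ; t = seriesTarget (b ∷ bs)
  ; s≢t = λ () }

IsString : (bs : List Block) → Set
IsString bs = (w : Fin (nV (seriesGraph bs))) → w ≢ seriesSource bs → w ≢ seriesTarget bs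
  → InTwoCycle (seriesGraph bs) w

Nontrivial : (bs : List Block) → Set
Nontrivial bs = 2 ℕ.< nV (seriesGraph bs)

-- Orientations and pseudoflows.
-- Each edge e = uv has a half-edge at u and one at v; 'inU e' (resp.
-- 'inV e') is true iff the half-edge at u (resp. v) points towards u (v).

record Orientation (G : SignedGraph) : Set where
  field
    inU inV : E G → Bool
    pos-ok : ∀ e → Edge.sign (ends G e) ≡ pos → inU e ≢ inV e
    neg-ok : ∀ e → Edge.sign (ends G e) ≡ neg → inU e ≡ inV e

halfValue : Bool → ℤ → ℤ
halfValue true x = x
halfValue false x = - x

netInflow : (G : SignedGraph) → Orientation G → (E G → ℤ) → Fin (nV G) → ℤ
netInflow G o val w = sumℤ (length (edges G)) λ e →
    (if ⌊ Edge.u (ends G e) Fin.≟ w ⌋ then halfValue (Orientation.inU o e) (val e) else 0ℤ)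
  + (if ⌊ Edge.v (ends G e) Fin.≟ w ⌋ then halfValue (Orientation.inV o e) (val e) else 0ℤ)

record Pseudoflow (T : TwoTerminal) (a b : ℤ) : Set where
  open TwoTerminal T
  field
    orient : Orientation graph
    val : E graph → ℤ
    val≢0 : ∀ e → val e ≢ 0ℤ
    val<6 : ∀ e → ∣ val e ∣ ℕ.< 6
    conservation : ∀ w → w ≢ s → w ≢ t → netInflow graph orient val w ≡ 0ℤ
    source-out : - netInflow graph orient val s ≡ a
    target-in : netInflow graph orient val t ≡ b

Valid : (T : TwoTerminal) → ℤ → ℤ → Set
Valid T a b = (a ≢ 0ℤ ⊎ 2 ℕ.≤ deg graph s) × (b ≢ 0ℤ ⊎ 2 ℕ.≤ deg graph t)
  where open TwoTerminal T

nontrivialTT : (bs : List Block) → Nontrivial bs → TwoTerminal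
nontrivialTT bs nt = seriesTwoTerminal bs (≤-trans (ℕ.s≤s ℕ.z≤n) (ℕ.s≤s⁻¹ nt))
  where open import Data.Nat.Properties using (≤-trans)

-- Across a K₂⁺-block the flow entering a vertex is passed on unchanged;
-- across a D-block whose negative edge carries c it changes from a to
-- a + 2c, the positive edge carrying a + c.  Keeping every intermediate
-- flow value in I₅ ∖ {0}, a D-block can thus take a to any a′ ≠ ±a of the
-- same parity, so a flow from a to b is a walk of length β(G) = #D-blocks in
-- this graph on I₅, and the three conditions are exactly those under which
-- such a walk exists.  Whether a first step leaves an admissible pair for
-- the remaining β − 1 blocks depends on β only through its parity and
-- whether β ≥ 2, so it is decided by evaluation over I₅ for β ∈ {2, 3}.
-- Validity makes the flow nonzero on a K₂⁺-block at either terminal.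

module Submission where

open import Defs
open import Data.Nat as ℕ using (ℕ)
open import Data.Nat.Divisibility as ℕD using ()
open import Data.Integer as ℤ using (ℤ; +_; -_; _-_; ∣_∣; 0ℤ)
open import Data.Integer.Divisibility as ℤD using ()
open import Data.List using (List)
open import Data.Product using (_×_)
open import Data.Sum using (_⊎_)
open import Relation.Nullary using (¬_)
open import Relation.Binary.PropositionalEquality using (_≡_; _≢_)

open import Data.Bool using (Bool; true; false; if_then_else_; _∧_)
open import Data.Empty using (⊥-elim)
open import Data.Fin as Fin using (Fin; zero; suc; toℕ; fromℕ; inject₁)
open import Data.Integer using (_+_)
open import Data.Integer.Tactic.RingSolver using (solve-∀)
open import Data.List using ([]; _∷_; _++_; map; length; lookup; head; last; concatMap; tabulate; allFin; upTo)
open import Data.List.Membership.Propositional using (_∈_)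
open import Data.List.Membership.Propositional.Properties using (∈-map⁺; ∈-++⁺ˡ; ∈-++⁺ʳ; ∈-upTo⁺)
open import Data.List.Relation.Unary.All as All using (All; all?)
open import Data.List.Relation.Unary.Any as Any using (Any; any?)
open import Data.Maybe using (just)
open import Data.Nat using (zero; suc; z≤n; s≤s)
open import Data.Product using (∃-syntax; _,_; proj₁; proj₂)
open import Data.Sum using (inj₁; inj₂)
open import Function using (_∘_; id)
open import Relation.Binary using (tri<; tri≈; tri>)
open import Relation.Binary.PropositionalEquality using (refl; sym; trans; cong; cong₂; subst; module ≡-Reasoning)
open import Relation.Nullary using (Dec; yes; no; does; ¬?)
open import Relation.Nullary.Decidable using (True; toWitness; _×-dec_; _⊎-dec_; _→-dec_; isYes≗does; dec-true)
import Data.Fin.Properties as FinP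
import Data.Integer.Properties as ℤP
import Data.List.Properties as ListP
import Data.Nat.Properties as ℕP

sumList : {A : Set} → (A → ℤ) → List A → ℤ
sumList f []       = 0ℤ
sumList f (x ∷ xs) = f x + sumList f xs

countList : {A : Set} → (A → Bool) → List A → ℕ
countList p []       = 0
countList p (x ∷ xs) = (if p x then 1 else 0) ℕ.+ countList p xs

sumList-++ : {A : Set} (f : A → ℤ) (xs ys : List A) →
  sumList f (xs ++ ys) ≡ sumList f xs + sumList f ys
sumList-++ f []       ys = sym (ℤP.+-identityˡ _)
sumList-++ f (x ∷ xs) ys =
  trans (cong (λ s → f x + s) (sumList-++ f xs ys)) (sym (ℤP.+-assoc (f x) _ _))

countList-++ : {A : Set} (p : A → Bool) (xs ys : List A) →
  countList p (xs ++ ys) ≡ countList p xs ℕ.+ countList p ys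
countList-++ p []       ys = refl
countList-++ p (x ∷ xs) ys =
  trans (cong (_ ℕ.+_) (countList-++ p xs ys)) (sym (ℕP.+-assoc (if p x then 1 else 0) _ _))

sumℤ-lookup : {A : Set} (f : A → ℤ) (xs : List A) {g : Fin (length xs) → ℤ} →
  (∀ i → g i ≡ f (lookup xs i)) → sumℤ (length xs) g ≡ sumList f xs
sumℤ-lookup f []       g≗ = refl
sumℤ-lookup f (x ∷ xs) g≗ = cong₂ _+_ (g≗ zero) (sumℤ-lookup f xs (g≗ ∘ suc))

count-lookup : {A : Set} (p : A → Bool) (xs : List A) {g : Fin (length xs) → Bool} →
  (∀ i → g i ≡ p (lookup xs i)) → count (length xs) g ≡ countList p xs
count-lookup p []       g≗ = refl
count-lookup p (x ∷ xs) g≗ =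
  cong₂ ℕ._+_ (cong (λ b → if b then 1 else 0) (g≗ zero)) (count-lookup p xs (g≗ ∘ suc))

count-cong : ∀ n {g h : Fin n → Bool} → (∀ i → g i ≡ h i) → count n g ≡ count n h
count-cong zero    g≗h = refl
count-cong (suc n) g≗h =
  cong₂ ℕ._+_ (cong (λ b → if b then 1 else 0) (g≗h zero)) (count-cong n (g≗h ∘ suc))

sumℕ-cong : ∀ n {g h : Fin n → ℕ} → (∀ i → g i ≡ h i) → sumℕ n g ≡ sumℕ n h
sumℕ-cong zero    g≗h = refl
sumℕ-cong (suc n) g≗h = cong₂ ℕ._+_ (g≗h zero) (sumℕ-cong n (g≗h ∘ suc))

sumℕ-≥ : ∀ n (g : Fin n → ℕ) i → g i ℕ.≤ sumℕ n g
sumℕ-≥ (suc n) g zero    = ℕP.m≤m+n (g zero) _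
sumℕ-≥ (suc n) g (suc i) = ℕP.≤-trans (sumℕ-≥ n (g ∘ suc) i) (ℕP.m≤n+m _ (g zero))

count-≥ : ∀ n (g : Fin n → Bool) i → g i ≡ true → 1 ℕ.≤ count n g
count-≥ (suc n) g zero    gi≡true rewrite gi≡true = s≤s z≤n
count-≥ (suc n) g (suc i) gi≡true =
  ℕP.≤-trans (count-≥ n (g ∘ suc) i gi≡true) (ℕP.m≤n+m _ (if g zero then 1 else 0))

shiftEdge : ∀ {n} → Edge n → Edge (suc n)
shiftEdge e = edge (suc (Edge.u e)) (suc (Edge.v e)) (Edge.sign e)

blockEdges-shift : ∀ {n} x (u v : Fin n) →
  blockEdges x (suc u) (suc v) ≡ map shiftEdge (blockEdges x u v)
blockEdges-shift K₂⁺ u v = refl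
blockEdges-shift D   u v = refl

seriesEdges-∷ : ∀ x bs → edges (seriesGraph (x ∷ bs))
  ≡ blockEdges x zero (suc zero) ++ map shiftEdge (edges (seriesGraph bs))
seriesEdges-∷ x bs = cong (blockEdges x zero (suc zero) ++_) (begin
    concatMap g (tabulate suc)               ≡⟨ cong (concatMap g) (ListP.map-tabulate id suc) ⟨
    concatMap g (map suc (allFin n))         ≡⟨ ListP.concatMap-map g suc (allFin n) ⟩
    concatMap (g ∘ suc) (allFin n)           ≡⟨ ListP.concatMap-cong shift-g (allFin n) ⟩
    concatMap (map shiftEdge ∘ h) (allFin n) ≡⟨ ListP.map-concatMap shiftEdge h (allFin n) ⟨
    map shiftEdge (concatMap h (allFin n))   ∎)
  where
  open ≡-Reasoning
  n : ℕ
  n = length bs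
  g : Fin (suc n) → List (Edge (suc (suc n)))
  g i = blockEdges (lookup (x ∷ bs) i) (inject₁ i) (suc i)
  h : Fin n → List (Edge (suc n))
  h i = blockEdges (lookup bs i) (inject₁ i) (suc i)
  shift-g : ∀ i → g (suc i) ≡ map shiftEdge (h i)
  shift-g i = blockEdges-shift (lookup bs i) (inject₁ i) (suc i)

-- Stated with `does` rather than `⌊_⌋`, which does not commute
-- definitionally with Fin.suc; this makes the shift lemmas hold by refl.
incident : ∀ {n} → Fin n → Edge n → Bool
incident w e = does ((Edge.u e Fin.≟ w) ⊎-dec (Edge.v e Fin.≟ w))

deg≡countList : ∀ G w → deg G w ≡ countList (incident w) (edges G)
deg≡countList G w = count-lookup (incident w) (edges G) (λ e → isYes≗does _)

countList-incident-shift-zero : ∀ {n} (es : List (Edge n)) →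
  countList (incident zero) (map shiftEdge es) ≡ 0
countList-incident-shift-zero []       = refl
countList-incident-shift-zero (e ∷ es) = countList-incident-shift-zero es

countList-incident-shift-suc : ∀ {n} (w : Fin n) (es : List (Edge n)) →
  countList (incident (suc w)) (map shiftEdge es) ≡ countList (incident w) es
countList-incident-shift-suc w []       = refl
countList-incident-shift-suc w (e ∷ es) = cong (_ ℕ.+_) (countList-incident-shift-suc w es)

deg-source-K₂⁺ : ∀ bs → head bs ≡ just K₂⁺ → deg (seriesGraph bs) zero ≡ 1
deg-source-K₂⁺ (K₂⁺ ∷ bs) refl = begin
  deg (seriesGraph (K₂⁺ ∷ bs)) zero
    ≡⟨ deg≡countList (seriesGraph (K₂⁺ ∷ bs)) zero ⟩
  countList (incident zero) (edges (seriesGraph (K₂⁺ ∷ bs)))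
    ≡⟨ cong (countList (incident zero)) (seriesEdges-∷ K₂⁺ bs) ⟩
  1 ℕ.+ countList (incident zero) (map shiftEdge es)
    ≡⟨ cong suc (countList-incident-shift-zero es) ⟩
  1 ∎
  where
  open ≡-Reasoning
  es : List (Edge (suc (length bs)))
  es = edges (seriesGraph bs)

deg-target-K₂⁺ : ∀ bs → last bs ≡ just K₂⁺ → deg (seriesGraph bs) (fromℕ (length bs)) ≡ 1
deg-target-K₂⁺ bs last≡K₂⁺ = trans (deg≡countList (seriesGraph bs) _) (incident-target bs last≡K₂⁺)
  where
  open ≡-Reasoning
  incident-target : ∀ bs → last bs ≡ just K₂⁺ →
    countList (incident (fromℕ (length bs))) (edges (seriesGraph bs)) ≡ 1
  incident-target (K₂⁺ ∷ []) _ = refl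
  incident-target (D ∷ [])   ()
  incident-target (x ∷ y ∷ bs) last≡K₂⁺ = begin
    countList t (edges (seriesGraph (x ∷ y ∷ bs)))
      ≡⟨ cong (countList t) (seriesEdges-∷ x (y ∷ bs)) ⟩
    countList t (blockEdges x zero (suc zero) ++ map shiftEdge es)
      ≡⟨ countList-++ t (blockEdges x zero (suc zero)) _ ⟩
    countList t (blockEdges x zero (suc zero)) ℕ.+ countList t (map shiftEdge es)
      ≡⟨ cong₂ ℕ._+_ (far x) (countList-incident-shift-suc _ es) ⟩
    countList (incident (fromℕ (length (y ∷ bs)))) es
      ≡⟨ incident-target (y ∷ bs) last≡K₂⁺ ⟩
    1 ∎
    where
    es : List (Edge (suc (length (y ∷ bs))))
    es = edges (seriesGraph (y ∷ bs))
    t : Edge (suc (length (x ∷ y ∷ bs))) → Bool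
    t = incident (fromℕ (length (x ∷ y ∷ bs)))
    far : ∀ x → countList t (blockEdges x zero (suc zero)) ≡ 0
    far K₂⁺ = refl
    far D   = refl

parallel : ∀ {n} → Edge n → Edge n → Bool
parallel e f = does (((Edge.u e Fin.≟ Edge.u f) ×-dec (Edge.v e Fin.≟ Edge.v f))
               ⊎-dec ((Edge.u e Fin.≟ Edge.v f) ×-dec (Edge.v e Fin.≟ Edge.u f)))

parallelPairs : ∀ {n} → List (Edge n) → ℕ
parallelPairs []       = 0
parallelPairs (e ∷ es) = countList (parallel e) es ℕ.+ parallelPairs es

β≡parallelPairs : ∀ G → β G ≡ parallelPairs (edges G)
β≡parallelPairs G = trans
  (sumℕ-cong (length (edges G)) λ i → count-cong (length (edges G)) λ j → isYes≗does _)
  (indexed≡parallelPairs (edges G))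
  where
  indexed≡parallelPairs : ∀ {n} (es : List (Edge n)) →
    sumℕ (length es) (λ i → count (length es) λ j →
      (suc (toℕ i) ℕ.≤ᵇ toℕ j) ∧ parallel (lookup es i) (lookup es j))
    ≡ parallelPairs es
  indexed≡parallelPairs []       = refl
  indexed≡parallelPairs (e ∷ es) =
    cong₂ ℕ._+_ (count-lookup (parallel e) es (λ _ → refl)) (indexed≡parallelPairs es)

countD : List Block → ℕ
countD []         = 0
countD (K₂⁺ ∷ bs) = countD bs
countD (D ∷ bs)   = suc (countD bs)

countList-parallel-shift-zero : ∀ {n} s (es : List (Edge (suc n))) →
  countList (parallel (edge zero (suc zero) s)) (map shiftEdge es) ≡ 0
countList-parallel-shift-zero s []       = refl
countList-parallel-shift-zero s (e ∷ es) = countList-parallel-shift-zero s es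

parallelPairs-shift : ∀ {n} (es : List (Edge n)) → parallelPairs (map shiftEdge es) ≡ parallelPairs es
parallelPairs-shift []       = refl
parallelPairs-shift (e ∷ es) = cong₂ ℕ._+_ (parallel-shift es) (parallelPairs-shift es)
  where
  parallel-shift : ∀ es → countList (parallel (shiftEdge e)) (map shiftEdge es) ≡ countList (parallel e) es
  parallel-shift []       = refl
  parallel-shift (f ∷ es) = cong (_ ℕ.+_) (parallel-shift es)

β-seriesGraph : ∀ bs → β (seriesGraph bs) ≡ countD bs
β-seriesGraph bs = trans (β≡parallelPairs (seriesGraph bs)) (pairs bs)
  where
  pairs : ∀ bs → parallelPairs (edges (seriesGraph bs)) ≡ countD bs
  pairs []       = refl
  pairs (x ∷ bs) = begin
    parallelPairs (edges (seriesGraph (x ∷ bs)))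
      ≡⟨ cong parallelPairs (seriesEdges-∷ x bs) ⟩
    parallelPairs (blockEdges x zero (suc zero) ++ map shiftEdge es)
      ≡⟨ block x ⟩
    countD (x ∷ []) ℕ.+ parallelPairs (map shiftEdge es)
      ≡⟨ cong (countD (x ∷ []) ℕ.+_) (trans (parallelPairs-shift es) (pairs bs)) ⟩
    countD (x ∷ []) ℕ.+ countD bs
      ≡⟨ countD-∷ x ⟩
    countD (x ∷ bs) ∎
    where
    open ≡-Reasoning
    es : List (Edge (suc (length bs)))
    es = edges (seriesGraph bs)
    block : ∀ x → parallelPairs (blockEdges x zero (suc zero) ++ map shiftEdge es)
                  ≡ countD (x ∷ []) ℕ.+ parallelPairs (map shiftEdge es)
    block K₂⁺ = cong (ℕ._+ parallelPairs (map shiftEdge es)) (countList-parallel-shift-zero pos es)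
    block D   = cong₂ (λ m n → suc m ℕ.+ (n ℕ.+ parallelPairs (map shiftEdge es)))
      (countList-parallel-shift-zero pos es) (countList-parallel-shift-zero neg es)
    countD-∷ : ∀ x → countD (x ∷ []) ℕ.+ countD bs ≡ countD (x ∷ bs)
    countD-∷ K₂⁺ = refl
    countD-∷ D   = refl

SameEnds-sym : ∀ G {e f} → SameEnds G e f → SameEnds G f e
SameEnds-sym G (inj₁ (u≡u , v≡v)) = inj₁ (sym u≡u , sym v≡v)
SameEnds-sym G (inj₂ (u≡v , v≡u)) = inj₂ (sym v≡u , sym u≡v)

β-positive-< : ∀ G (e f : E G) → toℕ e ℕ.< toℕ f → SameEnds G e f → 1 ℕ.≤ β G
β-positive-< G e f e<f e∥f = ℕP.≤-trans
  (count-≥ _ _ f (trans (isYes≗does _) (dec-true ((toℕ e ℕ.<? toℕ f) ×-dec sameEnds? G e f) (e<f , e∥f))))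
  (sumℕ-≥ _ _ e)

β-positive : ∀ G (e f : E G) → e ≢ f → SameEnds G e f → 1 ℕ.≤ β G
β-positive G e f e≢f e∥f with ℕP.<-cmp (toℕ e) (toℕ f)
... | tri< e<f _ _ = β-positive-< G e f e<f e∥f
... | tri≈ _ e≡f _ = ⊥-elim (e≢f (FinP.toℕ-injective e≡f))
... | tri> _ _ f<e = β-positive-< G f e f<e (SameEnds-sym G e∥f)

FlowValue : ℤ → Set
FlowValue x = x ≢ 0ℤ × ∣ x ∣ ℕ.≤ 5

-- Block x, valued p on its positive and c on its negative edge, takes
-- in the flow a at its source and passes on a′ at its target.
Carries : Block → (p c a a′ : ℤ) → Set
Carries K₂⁺ p c a a′ = a ≡ p × a′ ≡ p
Carries D   p c a a′ = a ≡ p - c × a′ ≡ p + c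

data SeriesFlow : List Block → ℤ → ℤ → Set where
  done : ∀ {a} → SeriesFlow [] a a
  step : ∀ {x bs p c a a′ b} → FlowValue p → FlowValue c → Carries x p c a a′ →
    SeriesFlow bs a′ b → SeriesFlow (x ∷ bs) a b

-- Indexed by blocks.  The value + 1 past the last block, like the value c
-- recorded for a K₂⁺-block, belongs to no edge.
positiveValues negativeValues : ∀ {bs a b} → SeriesFlow bs a b → ℕ → ℤ
positiveValues done                   _       = + 1
positiveValues (step {p = p} _ _ _ _) zero    = p
positiveValues (step _ _ _ F)         (suc i) = positiveValues F i
negativeValues done                   _       = + 1
negativeValues (step {c = c} _ _ _ _) zero    = c
negativeValues (step _ _ _ F)         (suc i) = negativeValues F i

positiveValues-valid : ∀ {bs a b} (F : SeriesFlow bs a b) i → FlowValue (positiveValues F i)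
positiveValues-valid done             _       = (λ ()) , s≤s z≤n
positiveValues-valid (step vp _ _ _)  zero    = vp
positiveValues-valid (step _ _ _ F)   (suc i) = positiveValues-valid F i

negativeValues-valid : ∀ {bs a b} (F : SeriesFlow bs a b) i → FlowValue (negativeValues F i)
negativeValues-valid done             _       = (λ ()) , s≤s z≤n
negativeValues-valid (step _ vc _ _)  zero    = vc
negativeValues-valid (step _ _ _ F)   (suc i) = negativeValues-valid F i

bySign : Sign → ℤ → ℤ → ℤ
bySign pos x y = x
bySign neg x y = y

-- Every edge has its tail at the source vertex of its block, whose index
-- is also the index of the block.
edgeValue : ∀ {n} → (ℕ → ℤ) → (ℕ → ℤ) → Edge n → ℤ
edgeValue P C e = bySign (Edge.sign e) (P (toℕ (Edge.u e))) (C (toℕ (Edge.u e)))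

edgeValue-valid : ∀ {n} {P C : ℕ → ℤ} → (∀ i → FlowValue (P i)) → (∀ i → FlowValue (C i)) →
  (e : Edge n) → FlowValue (edgeValue P C e)
edgeValue-valid vP vC e with Edge.sign e
... | pos = vP _
... | neg = vC _

tailPointsIn : Sign → Bool
tailPointsIn pos = false
tailPointsIn neg = true

forwardOrientation : ∀ G → Orientation G
forwardOrientation G = record
  { inU    = λ e → tailPointsIn (Edge.sign (ends G e))
  ; inV    = λ _ → true
  ; pos-ok = λ e s≡pos → subst (λ s → tailPointsIn s ≢ true) (sym s≡pos) (λ ())
  ; neg-ok = λ e s≡neg → subst (λ s → tailPointsIn s ≡ true) (sym s≡neg) refl
  }

inflow : ∀ {n} → (ℕ → ℤ) → (ℕ → ℤ) → Fin n → Edge n → ℤ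
inflow P C w e =
  (if does (Edge.u e Fin.≟ w) then halfValue (tailPointsIn (Edge.sign e)) (edgeValue P C e) else 0ℤ)
  + (if does (Edge.v e Fin.≟ w) then edgeValue P C e else 0ℤ)

netInflow-forward : ∀ G (P C : ℕ → ℤ) w →
  netInflow G (forwardOrientation G) (edgeValue P C ∘ ends G) w ≡ sumList (inflow P C w) (edges G)
netInflow-forward G P C w = sumℤ-lookup (inflow P C w) (edges G) λ i →
  let e = ends G i ; x = edgeValue P C e in
  cong₂ _+_ (cong (if_then halfValue (tailPointsIn (Edge.sign e)) x else 0ℤ) (isYes≗does (Edge.u e Fin.≟ w)))
            (cong (if_then x else 0ℤ) (isYes≗does (Edge.v e Fin.≟ w)))

inflow-shift-zero : ∀ {n} (P C : ℕ → ℤ) (es : List (Edge n)) →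
  sumList (inflow P C zero) (map shiftEdge es) ≡ 0ℤ
inflow-shift-zero P C []       = refl
inflow-shift-zero P C (e ∷ es) = trans (ℤP.+-identityˡ _) (inflow-shift-zero P C es)

inflow-shift-suc : ∀ {n} (P C : ℕ → ℤ) (w : Fin n) (es : List (Edge n)) →
  sumList (inflow P C (suc w)) (map shiftEdge es) ≡ sumList (inflow (P ∘ suc) (C ∘ suc) w) es
inflow-shift-suc P C w []       = refl
inflow-shift-suc P C w (e ∷ es) = cong (λ s → inflow (P ∘ suc) (C ∘ suc) w e + s) (inflow-shift-suc P C w es)

module _ {k : ℕ} (P C : ℕ → ℤ) where

  blockInflow : Block → Fin (suc (suc k)) → ℤ
  blockInflow x w = sumList (inflow P C w) (blockEdges x zero (suc zero))

  blockInflow-source : ∀ x {a a′} → Carries x (P 0) (C 0) a a′ → blockInflow x zero ≡ - a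
  blockInflow-source K₂⁺ (refl , _) = trans (ℤP.+-identityʳ _) (ℤP.+-identityʳ _)
  blockInflow-source D   (refl , _) = identity (P 0) (C 0)
    where
    identity : ∀ p c → (- p + 0ℤ) + ((c + 0ℤ) + 0ℤ) ≡ - (p - c)
    identity = solve-∀

  blockInflow-target : ∀ x {a a′} → Carries x (P 0) (C 0) a a′ → blockInflow x (suc zero) ≡ a′
  blockInflow-target K₂⁺ (_ , refl) = trans (ℤP.+-identityʳ _) (ℤP.+-identityˡ _)
  blockInflow-target D   (_ , refl) = identity (P 0) (C 0)
    where
    identity : ∀ p c → (0ℤ + p) + ((0ℤ + c) + 0ℤ) ≡ p + c
    identity = solve-∀

  blockInflow-far : ∀ x (j : Fin k) → blockInflow x (suc (suc j)) ≡ 0ℤ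
  blockInflow-far K₂⁺ j = refl
  blockInflow-far D   j = refl

flowInflow : ∀ {bs a b} → SeriesFlow bs a b → Fin (suc (length bs)) → ℤ
flowInflow {bs} F w = sumList (inflow (positiveValues F) (negativeValues F) w) (edges (seriesGraph bs))

flowInflow-∷ : ∀ {x bs a b} (F : SeriesFlow (x ∷ bs) a b) w → flowInflow F w
  ≡ blockInflow (positiveValues F) (negativeValues F) x w
    + sumList (inflow (positiveValues F) (negativeValues F) w) (map shiftEdge (edges (seriesGraph bs)))
flowInflow-∷ {x} {bs} F w =
  trans (cong (sumList f) (seriesEdges-∷ x bs)) (sumList-++ f (blockEdges x zero (suc zero)) _)
  where
  f : Edge (suc (length (x ∷ bs))) → ℤ
  f = inflow (positiveValues F) (negativeValues F) w

flowInflow-source : ∀ {x bs a b} (F : SeriesFlow (x ∷ bs) a b) → flowInflow F zero ≡ - a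
flowInflow-source {x} {bs} {a} F@(step _ _ carries _) = begin
  flowInflow F zero                                   ≡⟨ flowInflow-∷ F zero ⟩
  blockInflow P C x zero + sumList (inflow P C zero) (map shiftEdge (edges (seriesGraph bs)))
    ≡⟨ cong₂ _+_ (blockInflow-source P C x carries) (inflow-shift-zero P C (edges (seriesGraph bs))) ⟩
  - a + 0ℤ                                            ≡⟨ ℤP.+-identityʳ (- a) ⟩
  - a                                                 ∎
  where
  open ≡-Reasoning
  P C : ℕ → ℤ
  P = positiveValues F
  C = negativeValues F

flowInflow-target : ∀ {x bs a b} (F : SeriesFlow (x ∷ bs) a b) → flowInflow F (fromℕ (length (x ∷ bs))) ≡ b
flowInflow-target {x} {[]} F@(step _ _ carries done) =
  trans (flowInflow-∷ F (suc zero))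
        (trans (ℤP.+-identityʳ _) (blockInflow-target (positiveValues F) (negativeValues F) x carries))
flowInflow-target {x} {y ∷ bs} F@(step _ _ _ G) = begin
  flowInflow F (fromℕ (length (x ∷ y ∷ bs)))                               ≡⟨ flowInflow-∷ F _ ⟩
  blockInflow P C x (suc t) + sumList (inflow P C (suc t)) (map shiftEdge es)
    ≡⟨ cong₂ _+_ (blockInflow-far P C x _) (inflow-shift-suc P C t es) ⟩
  0ℤ + flowInflow G t                                                      ≡⟨ ℤP.+-identityˡ _ ⟩
  flowInflow G t                                                           ≡⟨ flowInflow-target G ⟩
  _                                                                        ∎
  where
  open ≡-Reasoning
  P C : ℕ → ℤ
  P = positiveValues F
  C = negativeValues F
  t : Fin (suc (length (y ∷ bs)))
  t = fromℕ (length (y ∷ bs))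
  es : List (Edge (suc (length (y ∷ bs))))
  es = edges (seriesGraph (y ∷ bs))

flowInflow-inner : ∀ {bs a b} (F : SeriesFlow bs a b) (w : Fin (suc (length bs))) →
  w ≢ zero → w ≢ fromℕ (length bs) → flowInflow F w ≡ 0ℤ
flowInflow-inner F zero w≢s _ = ⊥-elim (w≢s refl)
flowInflow-inner (step _ _ _ done) (suc zero) _ w≢t = ⊥-elim (w≢t refl)
flowInflow-inner {x ∷ bs} F@(step {a′ = a′} _ _ carries G@(step _ _ _ _)) (suc zero) _ _ = begin
  flowInflow F (suc zero)                                  ≡⟨ flowInflow-∷ F _ ⟩
  blockInflow P C x (suc zero) + sumList (inflow P C (suc zero)) (map shiftEdge es)
    ≡⟨ cong₂ _+_ (blockInflow-target P C x carries) (inflow-shift-suc P C zero es) ⟩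
  a′ + flowInflow G zero                                   ≡⟨ cong (_+_ a′) (flowInflow-source G) ⟩
  a′ - a′                                                  ≡⟨ ℤP.+-inverseʳ a′ ⟩
  0ℤ                                                       ∎
  where
  open ≡-Reasoning
  P C : ℕ → ℤ
  P = positiveValues F
  C = negativeValues F
  es : List (Edge (suc (length bs)))
  es = edges (seriesGraph bs)
flowInflow-inner {x ∷ bs} F@(step _ _ _ G) (suc (suc j)) _ w≢t = begin
  flowInflow F (suc (suc j))                               ≡⟨ flowInflow-∷ F _ ⟩
  blockInflow P C x (suc (suc j)) + sumList (inflow P C (suc (suc j))) (map shiftEdge es)
    ≡⟨ cong₂ _+_ (blockInflow-far P C x j) (inflow-shift-suc P C (suc j) es) ⟩
  0ℤ + flowInflow G (suc j)                                ≡⟨ ℤP.+-identityˡ _ ⟩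
  flowInflow G (suc j)                                     ≡⟨ flowInflow-inner G _ (λ ()) (w≢t ∘ cong suc) ⟩
  0ℤ                                                       ∎
  where
  open ≡-Reasoning
  P C : ℕ → ℤ
  P = positiveValues F
  C = negativeValues F
  es : List (Edge (suc (length bs)))
  es = edges (seriesGraph bs)

seriesFlow⇒pseudoflow : ∀ x bs {a b} (nt : Nontrivial (x ∷ bs)) →
  SeriesFlow (x ∷ bs) a b → Pseudoflow (nontrivialTT (x ∷ bs) nt) a b
seriesFlow⇒pseudoflow x bs {a} nt F = record
  { orient       = forwardOrientation G
  ; val          = edgeValue P C ∘ ends G
  ; val≢0        = proj₁ ∘ valid ∘ ends G
  ; val<6        = s≤s ∘ proj₂ ∘ valid ∘ ends G
  ; conservation = λ w w≢s w≢t → trans (netInflow-forward G P C w) (flowInflow-inner F w w≢s w≢t)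
  ; source-out   = trans (cong -_ (trans (netInflow-forward G P C zero) (flowInflow-source F)))
                         (ℤP.neg-involutive a)
  ; target-in    = trans (netInflow-forward G P C _) (flowInflow-target F)
  }
  where
  G : SignedGraph
  G = seriesGraph (x ∷ bs)
  P C : ℕ → ℤ
  P = positiveValues F
  C = negativeValues F
  valid : ∀ e → FlowValue (edgeValue P C e)
  valid = edgeValue-valid (positiveValues-valid F) (negativeValues-valid F)

Admissible : ℕ → ℤ → ℤ → Set
Admissible n a b =
  (¬ (2 ℕD.∣ n) × a ≢ b × a ≢ - b)
  ⊎ (2 ℕD.∣ n × (a ≡ b ⊎ a ≡ - b))
  ⊎ (2 ℕ.≤ n × (¬ ((+ 2) ℤD.∣ a) ⊎ a ≡ 0ℤ ⊎ b ≡ 0ℤ))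

admissible? : ∀ n a b → Dec (Admissible n a b)
admissible? n a b =
  (¬? (2 ℕD.∣? n) ×-dec ¬? (a ℤ.≟ b) ×-dec ¬? (a ℤ.≟ - b))
  ⊎-dec (2 ℕD.∣? n ×-dec (a ℤ.≟ b ⊎-dec a ℤ.≟ - b))
  ⊎-dec (2 ℕ.≤? n ×-dec (¬? (2 ℕD.∣? ∣ a ∣) ⊎-dec a ℤ.≟ 0ℤ ⊎-dec b ℤ.≟ 0ℤ))

Admissible-+2 : ∀ {n a b} → Admissible n a b → Admissible (2 ℕ.+ n) a b
Admissible-+2 (inj₁ (2∤n , a≢±b)) =
  inj₁ ((λ 2∣2+n → 2∤n (ℕD.∣m+n∣m⇒∣n 2∣2+n ℕD.∣-refl)) , a≢±b)
Admissible-+2 (inj₂ (inj₁ (2∣n , a≡±b))) =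
  inj₂ (inj₁ (ℕD.∣m∣n⇒∣m+n ℕD.∣-refl 2∣n , a≡±b))
Admissible-+2 {n} (inj₂ (inj₂ (2≤n , ab))) =
  inj₂ (inj₂ (ℕP.≤-trans 2≤n (ℕP.m≤n+m n 2) , ab))

Admissible-∸2 : ∀ {n a b} → 2 ℕ.≤ n → Admissible (2 ℕ.+ n) a b → Admissible n a b
Admissible-∸2 _ (inj₁ (2∤2+n , a≢±b)) =
  inj₁ ((λ 2∣n → 2∤2+n (ℕD.∣m∣n⇒∣m+n ℕD.∣-refl 2∣n)) , a≢±b)
Admissible-∸2 _ (inj₂ (inj₁ (2∣2+n , a≡±b))) =
  inj₂ (inj₁ (ℕD.∣m+n∣m⇒∣n 2∣2+n ℕD.∣-refl , a≡±b))
Admissible-∸2 2≤n (inj₂ (inj₂ (_ , ab))) =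
  inj₂ (inj₂ (2≤n , ab))

SameParity : ℤ → ℤ → Set
SameParity a b = (+ 2) ℤD.∣ (a - b)

sameParity? : ∀ a b → Dec (SameParity a b)
sameParity? a b = 2 ℕD.∣? ∣ a - b ∣

flowValue? : ∀ x → Dec (FlowValue x)
flowValue? x = ¬? (x ℤ.≟ 0ℤ) ×-dec ∣ x ∣ ℕ.≤? 5

-- Crossing a D-block whose negative edge carries c turns the flow a into
-- a + c + c, its positive edge carrying a + c.
CrossesD : ℤ → ℤ → Set
CrossesD a c = FlowValue c × FlowValue (a + c)

crossesD? : ∀ a c → Dec (CrossesD a c)
crossesD? a c = flowValue? c ×-dec flowValue? (a + c)

Continues : ℕ → ℤ → ℤ → Set
Continues n w b = FlowValue w × SameParity w b × Admissible n w b

continues? : ∀ n w b → Dec (Continues n w b)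
continues? n w b = flowValue? w ×-dec sameParity? w b ×-dec admissible? n w b

I₅ : List ℤ
I₅ = map ℤ.-[1+_] (upTo 5) ++ map +_ (upTo 6)

∈-I₅ : ∀ {a} → ∣ a ∣ ℕ.≤ 5 → a ∈ I₅
∈-I₅ {+ n}        n≤5 = ∈-++⁺ʳ (map ℤ.-[1+_] (upTo 5)) (∈-map⁺ +_ (∈-upTo⁺ (s≤s n≤5)))
∈-I₅ {ℤ.-[1+ n ]} n<5 = ∈-++⁺ˡ (∈-map⁺ ℤ.-[1+_] (∈-upTo⁺ n<5))

-- Opaque, so that the proof computed from `holds` is never unfolded where
-- the lemma is used.
opaque
  on-I₅² : {R : ℤ → ℤ → Set} (R? : ∀ a b → Dec (R a b)) → True (all? (λ a → all? (R? a) I₅) I₅) →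
    ∀ {a b} → ∣ a ∣ ℕ.≤ 5 → ∣ b ∣ ℕ.≤ 5 → R a b
  on-I₅² R? holds a≤5 b≤5 = All.lookup (All.lookup (toWitness holds) (∈-I₅ a≤5)) (∈-I₅ b≤5)

CrossableLast : ℤ → ℤ → Set
CrossableLast a b = SameParity a b → Admissible 1 a b → Any (λ c → CrossesD a c × a + c + c ≡ b) I₅

crossableLast? : ∀ a b → Dec (CrossableLast a b)
crossableLast? a b = sameParity? a b →-dec admissible? 1 a b →-dec
  any? (λ c → crossesD? a c ×-dec (a + c + c ℤ.≟ b)) I₅

crossLastD : ∀ {a b} → ∣ a ∣ ℕ.≤ 5 → ∣ b ∣ ℕ.≤ 5 → SameParity a b → Admissible 1 a b →
  ∃[ c ] CrossesD a c × a + c + c ≡ b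
crossLastD a≤5 b≤5 a≡b adm = Any.satisfied (on-I₅² crossableLast? _ a≤5 b≤5 a≡b adm)

Crossable : ℕ → ℤ → ℤ → Set
Crossable n a b = SameParity a b → Admissible (suc n) a b →
  Any (λ c → CrossesD a c × Continues n (a + c + c) b) I₅

crossable? : ∀ n a b → Dec (Crossable n a b)
crossable? n a b = sameParity? a b →-dec admissible? (suc n) a b →-dec
  any? (λ c → crossesD? a c ×-dec continues? n (a + c + c) b) I₅

crossD-by-evaluation : ∀ n → True (all? (λ a → all? (crossable? n a) I₅) I₅) →
  ∀ {a b} → ∣ a ∣ ℕ.≤ 5 → ∣ b ∣ ℕ.≤ 5 → SameParity a b → Admissible (suc n) a b →
  ∃[ c ] CrossesD a c × Continues n (a + c + c) b
crossD-by-evaluation n holds a≤5 b≤5 a≡b adm =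
  Any.satisfied (on-I₅² (crossable? n) holds a≤5 b≤5 a≡b adm)

crossD : ∀ n {a b} → 1 ℕ.≤ n → ∣ a ∣ ℕ.≤ 5 → ∣ b ∣ ℕ.≤ 5 → SameParity a b → Admissible (suc n) a b →
  ∃[ c ] CrossesD a c × Continues n (a + c + c) b
crossD 1 _ = crossD-by-evaluation 1 _
crossD 2 _ = crossD-by-evaluation 2 _
crossD (suc (suc (suc n))) _ a≤5 b≤5 a≡b adm
  with crossD (suc n) (s≤s z≤n) a≤5 b≤5 a≡b (Admissible-∸2 (s≤s (s≤s z≤n)) adm)
... | c , crosses , (vw , w≡b , adm′) = c , crosses , (vw , w≡b , Admissible-+2 adm′)

throughK₂⁺ : ∀ {bs a b} → FlowValue a → SeriesFlow bs a b → SeriesFlow (K₂⁺ ∷ bs) a b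
throughK₂⁺ va = step va va (refl , refl)

throughD : ∀ {bs a c b} → CrossesD a c → SeriesFlow bs (a + c + c) b → SeriesFlow (D ∷ bs) a b
throughD {a = a} {c} (vc , va+c) = step va+c vc (identity a c , refl)
  where
  identity : ∀ a c → a ≡ (a + c) - c
  identity = solve-∀

throughK₂⁺s : ∀ bs {a} → countD bs ≡ 0 → FlowValue a → SeriesFlow bs a a
throughK₂⁺s []         _    _  = done
throughK₂⁺s (K₂⁺ ∷ bs) noD va = throughK₂⁺ va (throughK₂⁺s bs noD va)

last-K₂⁺ : ∀ x bs → countD (x ∷ bs) ≡ 0 → last (x ∷ bs) ≡ just K₂⁺
last-K₂⁺ K₂⁺ []       _   = refl
last-K₂⁺ K₂⁺ (y ∷ bs) noD = last-K₂⁺ y bs noD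

ValidAtSource : List Block → ℤ → Set
ValidAtSource bs a = a ≢ 0ℤ ⊎ head bs ≢ just K₂⁺

ValidAtTarget : List Block → ℤ → Set
ValidAtTarget bs b = b ≢ 0ℤ ⊎ last bs ≢ just K₂⁺

ValidAtTarget-tail : ∀ x bs {b} → 1 ℕ.≤ countD bs → ValidAtTarget (x ∷ bs) b → ValidAtTarget bs b
ValidAtTarget-tail x []      ()
ValidAtTarget-tail x (_ ∷ _) _ atTarget = atTarget

trailingK₂⁺s : ∀ bs {b} → countD bs ≡ 0 → ∣ b ∣ ℕ.≤ 5 → ValidAtTarget (D ∷ bs) b → SeriesFlow bs b b
trailingK₂⁺s []       _   _   _                   = done
trailingK₂⁺s (y ∷ bs) noD b≤5 (inj₁ b≢0)          = throughK₂⁺s (y ∷ bs) noD (b≢0 , b≤5)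
trailingK₂⁺s (y ∷ bs) noD _   (inj₂ last≢K₂⁺) = ⊥-elim (last≢K₂⁺ (last-K₂⁺ y bs noD))

throughLastD : ∀ bs {a b} → countD bs ≡ 0 → ∣ a ∣ ℕ.≤ 5 → ∣ b ∣ ℕ.≤ 5 → SameParity a b →
  Admissible 1 a b → ValidAtTarget (D ∷ bs) b → SeriesFlow (D ∷ bs) a b
throughLastD bs noD a≤5 b≤5 a≡b adm atTarget with crossLastD a≤5 b≤5 a≡b adm
... | c , crosses , refl = throughD crosses (trailingK₂⁺s bs noD b≤5 atTarget)

admissible⇒seriesFlow : ∀ bs {a b} → ∣ a ∣ ℕ.≤ 5 → ∣ b ∣ ℕ.≤ 5 → SameParity a b →
  1 ℕ.≤ countD bs → Admissible (countD bs) a b →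
  ValidAtSource bs a → ValidAtTarget bs b → SeriesFlow bs a b
admissible⇒seriesFlow (K₂⁺ ∷ bs) a≤5 b≤5 a≡b D≥1 adm (inj₁ a≢0) atTarget = throughK₂⁺ (a≢0 , a≤5)
  (admissible⇒seriesFlow bs a≤5 b≤5 a≡b D≥1 adm (inj₁ a≢0) (ValidAtTarget-tail K₂⁺ bs D≥1 atTarget))
admissible⇒seriesFlow (K₂⁺ ∷ bs) _ _ _ _ _ (inj₂ head≢K₂⁺) _ = ⊥-elim (head≢K₂⁺ refl)
admissible⇒seriesFlow (D ∷ bs) {a} {b} a≤5 b≤5 a≡b _ adm _ atTarget with countD bs ℕ.≟ 0
... | yes noD = throughLastD bs noD a≤5 b≤5 a≡b (subst (λ n → Admissible (suc n) a b) noD adm) atTarget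
... | no someD with crossD (countD bs) (ℕP.n≢0⇒n>0 someD) a≤5 b≤5 a≡b adm
...   | c , crosses , ((w≢0 , w≤5) , w≡b , adm′) = throughD crosses
  (admissible⇒seriesFlow bs w≤5 b≤5 w≡b D≥1 adm′ (inj₁ w≢0) (ValidAtTarget-tail D bs D≥1 atTarget))
  where D≥1 = ℕP.n≢0⇒n>0 someD

2≰1 : ¬ (2 ℕ.≤ 1)
2≰1 (s≤s ())

validAtSource : ∀ bs {a} → a ≢ 0ℤ ⊎ 2 ℕ.≤ deg (seriesGraph bs) zero → ValidAtSource bs a
validAtSource bs (inj₁ a≢0) = inj₁ a≢0
validAtSource bs (inj₂ 2≤deg) =
  inj₂ λ head≡K₂⁺ → 2≰1 (subst (2 ℕ.≤_) (deg-source-K₂⁺ bs head≡K₂⁺) 2≤deg)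

validAtTarget : ∀ bs {b} → b ≢ 0ℤ ⊎ 2 ℕ.≤ deg (seriesGraph bs) (fromℕ (length bs)) →
  ValidAtTarget bs b
validAtTarget bs (inj₁ b≢0) = inj₁ b≢0
validAtTarget bs (inj₂ 2≤deg) =
  inj₂ λ last≡K₂⁺ → 2≰1 (subst (2 ℕ.≤_) (deg-target-K₂⁺ bs last≡K₂⁺) 2≤deg)

lemma14 : (bs : List Block) → IsString bs → (nt : Nontrivial bs) →
    (a b : ℤ) → ∣ a ∣ ℕ.≤ 5 → ∣ b ∣ ℕ.≤ 5 → (+ 2) ℤD.∣ (a - b) →
    Valid (nontrivialTT bs nt) a b →
    ((¬ (2 ℕD.∣ β (seriesGraph bs)) × a ≢ b × a ≢ - b)
      ⊎ (2 ℕD.∣ β (seriesGraph bs) × (a ≡ b ⊎ a ≡ - b))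
      ⊎ (2 ℕ.≤ β (seriesGraph bs) × (¬ ((+ 2) ℤD.∣ a) ⊎ a ≡ 0ℤ ⊎ b ≡ 0ℤ))) →
    Pseudoflow (nontrivialTT bs nt) a b
lemma14 []           _ (s≤s ())
lemma14 (_ ∷ [])     _ (s≤s (s≤s ()))
lemma14 (x ∷ y ∷ bs) string nt a b a≤5 b≤5 a≡b (atSource , atTarget) β-admissible =
  seriesFlow⇒pseudoflow x (y ∷ bs) nt (admissible⇒seriesFlow bs′ a≤5 b≤5 a≡b D≥1 admissible
    (validAtSource bs′ atSource) (validAtTarget bs′ atTarget))
  where
  bs′ : List Block
  bs′ = x ∷ y ∷ bs
  admissible : Admissible (countD bs′) a b
  admissible = subst (λ n → Admissible n a b) (β-seriesGraph bs′) β-admissible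
  D≥1 : 1 ℕ.≤ countD bs′
  D≥1 with string (suc zero) (λ ()) (λ ())
  ... | e , f , e≢f , e∥f , _ =
    subst (1 ℕ.≤_) (β-seriesGraph bs′) (β-positive (seriesGraph bs′) e f e≢f e∥f)
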